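{- Let $P$ be a finite set of propositional letters, let $G_1,G_2$ be P-graphs over $P$ and let $\varphi\in\mathcal{L}_0(P)$. Then $G_1\equiv_\varphi G_2$ iff there is some preference model $M=\langle\llbracket\varphi\rrbracket_0,\leq,v\rangle$ that is induced both by $G_1$ and by $G_2$, where $\llbracket\varphi\rrbracket_0$ denotes the set of all propositional valuations (subsets of $P$) satisfying $\varphi$.
   Context: $\mathcal{L}_0(P)$ is the classical propositional language over $P$. A preference model is a tuple $M=\langle W,\leq,v\rangle$ with $W\subseteq 2^P$ (worlds are propositional valuations), $\leq$ a reflexive and transitive relation on $W$, and $v(p)=\{w\in W: p\in w\}$. A P-graph is $G=\langle\Phi,\prec\rangle$ with $\Phi\subset\mathcal{L}_0(P)$ finite and $\prec$ a strict partial order on $\Phi$. $M$ is induced by $G$ iff for all $w,w'\in W$: $w\leq w'$ iff for every $\chi\in\Phi$, either ($w'\vDash\chi\Rightarrow w\vDash\chi$) or there is $\psi\in\Phi$ with $\psi\prec\chi$, $w\vDash\psi$, $w'\not\vDash\psi$. For a propositional formula $\varphi$, $G_1\equiv_\varphi G_2$ ($\varphi$-equivalence) means: for every preference model $M$ such that every world of $M$ satisfies $\varphi$, $G_1$ induces $M$ iff $G_2$ induces $M$. -}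

module Defs where

open import Data.Nat using (ℕ)
open import Data.Fin using (Fin)
open import Data.Bool using (Bool; true; false; not; _∧_; _∨_)
open import Data.List using (List)
open import Data.List.Membership.Propositional using (_∈_)
open import Data.Product using (Σ; _×_; ∃-syntax)
open import Data.Sum using (_⊎_)
open import Relation.Nullary using (¬_)
open import Relation.Binary.PropositionalEquality using (_≡_)
open import Function.Bundles using (_⇔_)

-- The set of propositional letters P is Fin n (an arbitrary finite set).
-- A valuation (a world, i.e. a subset of P) is its characteristic function.
Val : ℕ → Set
Val n = Fin n → Bool

data Form (n : ℕ) : Set where
  var  : Fin n → Form n
  ⊤ᶠ   : Form n
  ⊥ᶠ   : Form n
  ¬ᶠ_  : Form n → Form n
  _∧ᶠ_ : Form n → Form n → Form n
  _∨ᶠ_ : Form n → Form n → Form n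
  _⇒ᶠ_ : Form n → Form n → Form n

eval : ∀ {n} → Form n → Val n → Bool
eval (var p)   w = w p
eval ⊤ᶠ        w = true
eval ⊥ᶠ        w = false
eval (¬ᶠ a)    w = not (eval a w)
eval (a ∧ᶠ b)  w = eval a w ∧ eval b w
eval (a ∨ᶠ b)  w = eval a w ∨ eval b w
eval (a ⇒ᶠ b)  w = not (eval a w) ∨ eval b w

_⊨_ : ∀ {n} → Val n → Form n → Set
w ⊨ φ = eval φ w ≡ true

-- A preference model with world set W ⊆ 2^P: a preorder on W.
-- (The valuation v(p) = {w ∈ W : p ∈ w} is determined by W, so it is not
-- a field.)
record PrefModel (n : ℕ) (W : Val n → Set) : Set₁ where
  field
    _≤_   : Val n → Val n → Set
    ≤-refl  : ∀ {w} → W w → w ≤ w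
    ≤-trans : ∀ {w w' w''} → W w → W w' → W w'' → w ≤ w' → w' ≤ w'' → w ≤ w''

record PGraph (n : ℕ) : Set₁ where
  field
    Φ   : List (Form n)
    _≺_ : Form n → Form n → Set
    ≺-irrefl : ∀ {χ} → χ ∈ Φ → ¬ (χ ≺ χ)
    ≺-trans  : ∀ {χ ψ θ} → χ ∈ Φ → ψ ∈ Φ → θ ∈ Φ → χ ≺ ψ → ψ ≺ θ → χ ≺ θ

GLeq : ∀ {n} → PGraph n → Val n → Val n → Set
GLeq G w w' =
  ∀ χ → χ ∈ Φ →
    ((w' ⊨ χ → w ⊨ χ) ⊎ (∃[ ψ ] (ψ ∈ Φ × ψ ≺ χ × w ⊨ ψ × ¬ (w' ⊨ ψ))))
  where open PGraph G

Induces : ∀ {n} {W : Val n → Set} → PGraph n → PrefModel n W → Set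
Induces {n} {W} G M =
  ∀ w w' → W w → W w' → (PrefModel._≤_ M w w' ⇔ GLeq G w w')

_≡[_]_ : ∀ {n} → PGraph n → Form n → PGraph n → Set₁
_≡[_]_ {n} G₁ φ G₂ =
  ∀ (W : Val n → Set) (M : PrefModel n W) → (∀ w → W w → w ⊨ φ) →
    (Induces G₁ M ⇔ Induces G₂ M)

⟦_⟧₀ : ∀ {n} → Form n → Val n → Set
⟦ φ ⟧₀ w = w ⊨ φ

-- The relation GLeq G determined by a P-graph is always a preorder, so G
-- induces a model on every set of worlds. Hence φ-equivalence yields a common
-- model, the one induced by G₁ on ⟦ φ ⟧₀; conversely a common model forces
-- GLeq G₁ and GLeq G₂ to agree on φ-worlds, which transfers inducedness between
-- the graphs for every model on φ-worlds. Transitivity of GLeq G uses that ≺ is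
-- well-founded on the finite set Φ: a formula separating w from w'' in one of
-- the two steps is followed down ≺ until a witness of the right polarity appears.

module Submission where

open import Defs
open import Data.Nat using (ℕ)
open import Data.Product using (Σ; _×_)
open import Function.Bundles using (_⇔_)

open import Data.Bool using (true)
open import Data.Bool.Properties using () renaming (_≟_ to _≟ᵇ_)
open import Data.Empty using (⊥-elim)
open import Data.Fin using (Fin)
open import Data.Fin.Induction using (spo-wellFounded)
open import Data.List using (lookup; length)
open import Data.List.Membership.Propositional using (_∈_)
open import Data.List.Membership.Propositional.Properties using (∈-lookup)
open import Data.List.Relation.Unary.Any using (index)
open import Data.List.Relation.Unary.Any.Properties using (lookup-index)
open import Data.Product using (_,_; ∃-syntax)
open import Data.Sum using (_⊎_; inj₁; inj₂)
open import Function.Bundles using (mk⇔; Equivalence)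
open import Function.Construct.Composition using (_⇔-∘_)
open import Function.Construct.Symmetry using (⇔-sym)
open import Induction.WellFounded using (Acc; acc)
open import Relation.Binary.PropositionalEquality using (_≡_; refl; sym; subst; isEquivalence)
open import Relation.Binary.Structures using (IsStrictPartialOrder)
open import Relation.Nullary using (¬_; Dec; yes; no)

_⊨?_ : ∀ {n} (w : Val n) (χ : Form n) → Dec (w ⊨ χ)
w ⊨? χ = eval χ w ≟ᵇ true

module _ {n : ℕ} (G : PGraph n) where
  open PGraph G

  private
    _⊏_ : Fin (length Φ) → Fin (length Φ) → Set
    i ⊏ j = lookup Φ i ≺ lookup Φ j

    ⊏-isStrictPartialOrder : IsStrictPartialOrder _≡_ _⊏_
    ⊏-isStrictPartialOrder = record
      { isEquivalence = isEquivalence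
      ; irrefl        = λ { {i} refl → ≺-irrefl (∈-lookup i) }
      ; trans         = λ {i} {j} {k} → ≺-trans (∈-lookup i) (∈-lookup j) (∈-lookup k)
      ; <-resp-≈      = (λ { refl p → p }) , (λ { refl p → p })
      }

  ≺-induction : (P : Form n → Set) →
    (∀ {χ} → χ ∈ Φ → (∀ {ψ} → ψ ∈ Φ → ψ ≺ χ → P ψ) → P χ) →
    ∀ {χ} → χ ∈ Φ → P χ
  ≺-induction P step χ∈Φ = atIndex χ∈Φ (spo-wellFounded ⊏-isStrictPartialOrder _)
    where
    atLookup : ∀ i → Acc _⊏_ i → P (lookup Φ i)
    atIndex : ∀ {χ} (χ∈Φ : χ ∈ Φ) → Acc _⊏_ (index χ∈Φ) → P χ

    atLookup i (acc rs) = step (∈-lookup i) λ ψ∈Φ ψ≺χ →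
      atIndex ψ∈Φ (rs (subst (_≺ lookup Φ i) (lookup-index ψ∈Φ) ψ≺χ))
    atIndex χ∈Φ a = subst P (sym (lookup-index χ∈Φ)) (atLookup (index χ∈Φ) a)

  Witness : Val n → Val n → Form n → Set
  Witness w w' χ = ∃[ ψ ] (ψ ∈ Φ × ψ ≺ χ × w ⊨ ψ × ¬ (w' ⊨ ψ))

  Witness-≺ : ∀ {w w' ψ χ} → ψ ∈ Φ → χ ∈ Φ → ψ ≺ χ → Witness w w' ψ → Witness w w' χ
  Witness-≺ ψ∈Φ χ∈Φ ψ≺χ (θ , θ∈Φ , θ≺ψ , wθ , w'⊭θ) =
    θ , θ∈Φ , ≺-trans θ∈Φ ψ∈Φ χ∈Φ θ≺ψ ψ≺χ , wθ , w'⊭θ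

  GLeq⇒Witness : ∀ {w w' χ} → GLeq G w w' → χ ∈ Φ → ¬ (w ⊨ χ) → w' ⊨ χ → Witness w w' χ
  GLeq⇒Witness w≤w' χ∈Φ w⊭χ w'χ with w≤w' _ χ∈Φ
  ... | inj₁ inherit = ⊥-elim (w⊭χ (inherit w'χ))
  ... | inj₂ witness = witness

  GLeq-refl : ∀ w → GLeq G w w
  GLeq-refl w _ _ = inj₁ λ wχ → wχ

  module _ {w w' w'' : Val n} (w≤w' : GLeq G w w') (w'≤w'' : GLeq G w' w'') where

    Separates : Form n → Set
    Separates χ = (¬ (w ⊨ χ) × w' ⊨ χ) ⊎ (¬ (w' ⊨ χ) × w'' ⊨ χ)

    Separates⇒Witness : ∀ {χ} → χ ∈ Φ → Separates χ → Witness w w'' χ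
    Separates⇒Witness = ≺-induction (λ χ → Separates χ → Witness w w'' χ) step
      where
      step : ∀ {χ} → χ ∈ Φ → (∀ {ψ} → ψ ∈ Φ → ψ ≺ χ → Separates ψ → Witness w w'' ψ) →
             Separates χ → Witness w w'' χ
      step χ∈Φ ih (inj₁ (w⊭χ , w'χ)) with GLeq⇒Witness w≤w' χ∈Φ w⊭χ w'χ
      ... | ψ , ψ∈Φ , ψ≺χ , wψ , w'⊭ψ with w'' ⊨? ψ
      ...   | no w''⊭ψ = ψ , ψ∈Φ , ψ≺χ , wψ , w''⊭ψ
      ...   | yes w''ψ = Witness-≺ ψ∈Φ χ∈Φ ψ≺χ (ih ψ∈Φ ψ≺χ (inj₂ (w'⊭ψ , w''ψ)))
      step χ∈Φ ih (inj₂ (w'⊭χ , w''χ)) with GLeq⇒Witness w'≤w'' χ∈Φ w'⊭χ w''χ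
      ... | ψ , ψ∈Φ , ψ≺χ , w'ψ , w''⊭ψ with w ⊨? ψ
      ...   | yes wψ = ψ , ψ∈Φ , ψ≺χ , wψ , w''⊭ψ
      ...   | no w⊭ψ = Witness-≺ ψ∈Φ χ∈Φ ψ≺χ (ih ψ∈Φ ψ≺χ (inj₁ (w⊭ψ , w'ψ)))

    GLeq-trans : GLeq G w w''
    GLeq-trans χ χ∈Φ with w ⊨? χ | w'' ⊨? χ
    ... | yes wχ | _        = inj₁ λ _ → wχ
    ... | no _   | no w''⊭χ = inj₁ λ w''χ → ⊥-elim (w''⊭χ w''χ)
    ... | no w⊭χ | yes w''χ with w' ⊨? χ
    ...   | yes w'χ  = inj₂ (Separates⇒Witness χ∈Φ (inj₁ (w⊭χ , w'χ)))
    ...   | no w'⊭χ = inj₂ (Separates⇒Witness χ∈Φ (inj₂ (w'⊭χ , w''χ)))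

  inducedModel : (W : Val n → Set) → PrefModel n W
  inducedModel W = record
    { _≤_     = GLeq G
    ; ≤-refl  = λ {w} _ → GLeq-refl w
    ; ≤-trans = λ _ _ _ → GLeq-trans
    }

  induces-inducedModel : ∀ {W} → Induces G (inducedModel W)
  induces-inducedModel w w' _ _ = mk⇔ (λ w≤w' → w≤w') (λ w≤w' → w≤w')

commonModel-transfer : ∀ {n} {V W : Val n → Set} (G₁ G₂ : PGraph n) (M₀ : PrefModel n W) →
  Induces G₁ M₀ → Induces G₂ M₀ → (∀ w → V w → W w) →
  (M : PrefModel n V) → Induces G₁ M → Induces G₂ M
commonModel-transfer {W = W} G₁ G₂ M₀ ind₁ ind₂ V⊆W M ind w w' Vw Vw' =
  (ind₂ w w' Ww Ww' ⇔-∘ ⇔-sym (ind₁ w w' Ww Ww')) ⇔-∘ ind w w' Vw Vw'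
  where
  Ww : W w
  Ww = V⊆W w Vw
  Ww' : W w'
  Ww' = V⊆W w' Vw'

proposition2 : ∀ (n : ℕ) (G₁ G₂ : PGraph n) (φ : Form n) →
    (G₁ ≡[ φ ] G₂) ⇔ Σ (PrefModel n ⟦ φ ⟧₀) (λ M → Induces G₁ M × Induces G₂ M)
proposition2 n G₁ G₂ φ = mk⇔ equivalent⇒common common⇒equivalent
  where
  equivalent⇒common : G₁ ≡[ φ ] G₂ → Σ (PrefModel n ⟦ φ ⟧₀) (λ M → Induces G₁ M × Induces G₂ M)
  equivalent⇒common G₁≡G₂ = M₁ , ind₁ , Equivalence.to (G₁≡G₂ ⟦ φ ⟧₀ M₁ (λ _ φw → φw)) ind₁
    where
    M₁ : PrefModel n ⟦ φ ⟧₀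
    M₁ = inducedModel G₁ ⟦ φ ⟧₀
    ind₁ : Induces G₁ M₁
    ind₁ = induces-inducedModel G₁

  common⇒equivalent : Σ (PrefModel n ⟦ φ ⟧₀) (λ M → Induces G₁ M × Induces G₂ M) → G₁ ≡[ φ ] G₂
  common⇒equivalent (M₀ , ind₁ , ind₂) W M W⊆⟦φ⟧ =
    mk⇔ (commonModel-transfer G₁ G₂ M₀ ind₁ ind₂ W⊆⟦φ⟧ M)
        (commonModel-transfer G₂ G₁ M₀ ind₂ ind₁ W⊆⟦φ⟧ M)
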